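{- Let $G_i$ be a finite simple undirected graph with an orientation $\overline{G}_i$ in which there is no improving path between any two vertices. Insert an edge $\{u,v\}\notin E(G_i)$ using the Insert procedure of StrongDynOpt, and suppose the call FindAndFlipPath$(u)$ finds an improving path $P$ (which is then flipped). Then the resulting orientation $\overline{G}_{i+1}$ contains no improving path.
   Context: An orientation of an undirected graph $G=(V,E)$ is a directed graph $\vec{G}=(V,E')$ such that for every $\{x,y\}\in E$ exactly one of $(x,y),(y,x)$ lies in $E'$; $\mathrm{odeg}(x,\vec{G})$ is the number of edges of $E'$ starting at $x$. A directed path $\langle v_0,\dots,v_k\rangle$ in $\vec{G}$ is an improving path if $\mathrm{odeg}(v_0,\vec{G})>\mathrm{odeg}(v_k,\vec{G})+1$. Flipping an edge $(x,y)$ means replacing it by $(y,x)$; out-degrees below always refer to the current orientation at the moment they are evaluated. FindAndFlipPath$(x)$ (a depth-first search, with a visited array that is all false at the start of each top-level call): if $x$ is visited, return false; for each out-neighbour $y$ of $x$, if $\mathrm{odeg}(y)<\mathrm{odeg}(x)-1$, flip $(x,y)$ and return true; mark $x$ visited; for each out-neighbour $y$ of $x$ with $\mathrm{odeg}(y)=\mathrm{odeg}(x)-1$, if FindAndFlipPath$(y)$ returns true, flip $(x,y)$ and return true; return false. When the call returns true, the edges it flipped form (before flipping) a directed path of the orientation on which it was called; this is the path it is said to find. StrongDynOpt Insert$\{u,v\}$: label the endpoints so that $\mathrm{odeg}(u)\le\mathrm{odeg}(v)$ in the current orientation, add the directed edge $(u,v)$, and call FindAndFlipPath$(u)$. -}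

module Defs where

open import Data.Nat using (ℕ; zero; suc; _+_; _<_; _≤_)
open import Data.Bool using (Bool; true; false; if_then_else_; _∧_)
open import Data.Fin using (Fin; _≟_)
open import Data.List using (List; []; _∷_; map; allFin)
open import Data.Nat.ListAction using (sum)
open import Data.List.NonEmpty using (List⁺; _∷_; _∷⁺_; head; last; toList)
open import Data.List.Membership.Propositional using (_∈_; _∉_)
open import Data.List.Relation.Unary.Unique.Propositional using (Unique)
open import Data.List.Relation.Unary.Linked using (Linked)
open import Relation.Nullary.Decidable using (⌊_⌋)
open import Relation.Nullary using (¬_)
open import Relation.Binary.PropositionalEquality using (_≡_)
open import Data.Product using (_×_)

Orient : ℕ → Set
Orient n = Fin n → Fin n → Bool

-- D is an orientation of a finite simple undirected graph (the graph whose edges are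
-- the pairs {x,y} with an arc in either direction): no loops, and at most one direction per pair.
record IsOrientation {n : ℕ} (D : Orient n) : Set where
  field
    noLoop : ∀ x → D x x ≡ false
    antisym : ∀ x y → D x y ≡ true → D y x ≡ false

odeg : {n : ℕ} → Orient n → Fin n → ℕ
odeg {n} D x = sum (map (λ y → if D x y then 1 else 0) (allFin n))

flipArc : {n : ℕ} → Orient n → Fin n → Fin n → Orient n
flipArc D x y a b =
  if ⌊ a ≟ y ⌋ ∧ ⌊ b ≟ x ⌋ then true
  else if ⌊ a ≟ x ⌋ ∧ ⌊ b ≟ y ⌋ then false
  else D a b

addArc : {n : ℕ} → Orient n → Fin n → Fin n → Orient n
addArc D u v a b = if ⌊ a ≟ u ⌋ ∧ ⌊ b ≟ v ⌋ then true else D a b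

IsImprovingPath : {n : ℕ} → Orient n → List⁺ (Fin n) → Set
IsImprovingPath D p =
  Linked (λ a b → D a b ≡ true) (toList p) × Unique (toList p) × (suc (odeg D (last p)) < odeg D (head p))

NoImprovingPath : {n : ℕ} → Orient n → Set
NoImprovingPath {n} D = (p : List⁺ (Fin n)) → ¬ IsImprovingPath D p

Visited : ℕ → Set
Visited n = Fin n → Bool

mark : {n : ℕ} → Visited n → Fin n → Visited n
mark vis x z = if ⌊ z ≟ x ⌋ then true else vis z

allFalse : {n : ℕ} → Visited n
allFalse _ = false

-- Outcome of FindAndFlipPath: either false (with the updated visited array; the
-- orientation is unchanged), or true together with the resulting orientation and the
-- path that was found (whose arcs were flipped).
data Outcome (n : ℕ) : Set where
  fail  : Visited n → Outcome n
  found : Orient n → List⁺ (Fin n) → Outcome n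

-- Big-step semantics of FindAndFlipPath(x) run on orientation D with visited array vis.
-- The out-neighbours are scanned in an arbitrary (nondeterministically chosen) order.
-- "odeg(y) < odeg(x) - 1" is written  suc (odeg y) < odeg x  and
-- "odeg(y) = odeg(x) - 1" is written  suc (odeg y) ≡ odeg x.
mutual
  data FindAndFlip {n : ℕ} (D : Orient n) : Visited n → Fin n → Outcome n → Set where
    visitedF : ∀ {vis x} → vis x ≡ true → FindAndFlip D vis x (fail vis)
    direct : ∀ {vis x y} → vis x ≡ false → D x y ≡ true → suc (odeg D y) < odeg D x →
             FindAndFlip D vis x (found (flipArc D x y) (x ∷ y ∷ []))
    scan : ∀ {vis x out} → vis x ≡ false →
           (∀ y → D x y ≡ true → ¬ (suc (odeg D y) < odeg D x)) →
           Scan D x [] (mark vis x) out →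
           FindAndFlip D vis x out

  -- Scan D x tried vis out : the loop over the candidate out-neighbours of x, where
  -- 'tried' are the candidates already processed (each returned false).
  data Scan {n : ℕ} (D : Orient n) (x : Fin n) : List (Fin n) → Visited n → Outcome n → Set where
    done : ∀ {tried vis} →
           (∀ y → D x y ≡ true → suc (odeg D y) ≡ odeg D x → y ∈ tried) →
           Scan D x tried vis (fail vis)
    next : ∀ {tried vis vis' y out} → D x y ≡ true → suc (odeg D y) ≡ odeg D x → y ∉ tried →
           FindAndFlip D vis y (fail vis') →
           Scan D x (y ∷ tried) vis' out →
           Scan D x tried vis out
    succ : ∀ {tried vis y D' p} → D x y ≡ true → suc (odeg D y) ≡ odeg D x → y ∉ tried →
           FindAndFlip D vis y (found D' p) →
           Scan D x tried vis (found (flipArc D' x y) (x ∷⁺ p))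

{-# OPTIONS --safe #-}
-- Since D has no improving path, every steep arc (a, c) of D + (u, v), i.e. one with
-- odeg c < odeg a - 1, starts at u.  FindAndFlipPath only descends to vertices of smaller
-- out-degree, so the path it finds is a single steep arc (u, b), and odeg b < odeg u ≤ odeg v.
-- After the flip only b has gained out-degree, by one.  Having no improving path means
-- odeg x ≤ odeg z + 1 along every walk x ⇝ z (a walk contains a path with the same ends).
-- Every walk of the new orientation lifts to a walk of D from the same vertex ending at a
-- vertex of no larger out-degree: the new arc u → v is traded for u → b, the reversed arc
-- b → u for the empty walk at b; both are allowed since odeg b ≤ odeg z for every z reachable
-- in D from u or from v.
module Submission where

open import Defs
open import Data.Nat using (ℕ; zero; suc; _+_; _≤_; _<_; z≤n; s≤s)
open import Data.Nat.Properties
  using (≤-refl; ≤-reflexive; ≤-trans; <-trans; <-irrefl; ≤-pred; +-mono-≤; +-suc;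
         suc-injective; n<1+n; n≤1+n; <⇒≱; ≮⇒≥; module ≤-Reasoning)
open import Data.Bool using (Bool; true; false; if_then_else_; _∧_)
open import Data.Fin using (Fin; zero; suc; _≟_)
open import Data.Fin.Properties using () renaming (suc-injective to fsuc-injective)
open import Data.List using (List; []; _∷_; tabulate; initLast; _∷ʳ′_)
open import Data.List.Properties using (map-tabulate)
open import Data.Nat.ListAction using (sum)
open import Data.List.NonEmpty using (List⁺; _∷_; _∷⁺_; head; last; toList)
open import Data.List.Relation.Unary.Linked using (Linked; [-]; _∷_)
open import Data.List.Relation.Unary.AllPairs using ([]; _∷_)
open import Data.List.Relation.Unary.All using ([]; _∷_)
open import Data.List.Relation.Unary.All.Properties.Core using (¬Any⇒All¬)
open import Data.List.Relation.Unary.Any using (here; there; any?)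
open import Data.List.Relation.Unary.Unique.Propositional using (Unique)
open import Data.List.Membership.Propositional using (_∈_)
open import Data.Product using (Σ; ∃; ∃₂; _×_; _,_; proj₁; proj₂)
open import Data.Sum using (_⊎_; inj₁; inj₂)
open import Data.Empty using (⊥-elim)
open import Function using (id; _∘_; case_of_)
open import Relation.Binary.Construct.Closure.ReflexiveTransitive using (Star; ε; _◅_)
open import Relation.Binary.PropositionalEquality
open import Relation.Nullary using (¬_; Dec; yes; no; _×-dec_; contradiction)
open import Relation.Nullary.Decidable using (isYes; decidable-stable)

private
  variable
    n : ℕ
    F : Orient n
    a c u v x y z : Fin n

Arc : Orient n → Fin n → Fin n → Set
Arc F a c = F a c ≡ true

count : (Fin n → Bool) → ℕ
count r = sum (tabulate (λ y → if r y then 1 else 0))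

odeg≡count : (F : Orient n) (x : Fin n) → odeg F x ≡ count (F x)
odeg≡count F x = cong sum (map-tabulate id (λ y → if F x y then 1 else 0))

count-mono : {r s : Fin n → Bool} → (∀ z → r z ≡ true → s z ≡ true) → count r ≤ count s
count-mono {zero}  r⊆s = z≤n
count-mono {suc n} r⊆s = +-mono-≤ (indicator-mono (r⊆s zero)) (count-mono (r⊆s ∘ suc))
  where
  indicator-mono : {p q : Bool} → (p ≡ true → q ≡ true) → (if p then 1 else 0) ≤ (if q then 1 else 0)
  indicator-mono {false} _ = z≤n
  indicator-mono {true}  p⇒q rewrite p⇒q refl = ≤-refl

count-cong : {r s : Fin n → Bool} → (∀ z → r z ≡ s z) → count r ≡ count s
count-cong {zero}  r≗s = refl
count-cong {suc n} r≗s =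
  cong₂ (λ p k → (if p then 1 else 0) + k) (r≗s zero) (count-cong (r≗s ∘ suc))

count-insert : {r s : Fin n → Bool} (w : Fin n) → (∀ z → z ≢ w → r z ≡ s z) →
               r w ≡ true → s w ≡ false → count r ≡ suc (count s)
count-insert {suc n} zero agree rw sw rewrite rw | sw =
  cong suc (count-cong (λ z → agree (suc z) λ ()))
count-insert {suc n} {r} {s} (suc w) agree rw sw = begin
  (if r zero then 1 else 0) + count (r ∘ suc)       ≡⟨ cong₂ (λ p k → (if p then 1 else 0) + k)
                                                              (agree zero λ ()) tail-insert ⟩
  (if s zero then 1 else 0) + suc (count (s ∘ suc)) ≡⟨ +-suc _ _ ⟩
  suc (count s)                                     ∎
  where
  open ≡-Reasoning
  tail-insert : count (r ∘ suc) ≡ suc (count (s ∘ suc))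
  tail-insert = count-insert w (λ z z≢w → agree (suc z) (z≢w ∘ fsuc-injective)) rw sw

odeg-mono : (F G : Orient n) (x : Fin n) → (∀ z → Arc F x z → Arc G x z) → odeg F x ≤ odeg G x
odeg-mono F G x F⊆G rewrite odeg≡count F x | odeg≡count G x = count-mono F⊆G

odeg-cong : (F G : Orient n) (x : Fin n) → (∀ z → F x z ≡ G x z) → odeg F x ≡ odeg G x
odeg-cong F G x F≗G rewrite odeg≡count F x | odeg≡count G x = count-cong F≗G

odeg-insert : (F G : Orient n) (x w : Fin n) → (∀ z → z ≢ w → F x z ≡ G x z) →
              F x w ≡ true → G x w ≡ false → odeg F x ≡ suc (odeg G x)
odeg-insert F G x w agree Fxw Gxw rewrite odeg≡count F x | odeg≡count G x =
  count-insert w agree Fxw Gxw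

module _ {P Q : Set} {A : Set} {t e : A} where

  if-both : (p : Dec P) (q : Dec Q) → P × Q → (if isYes p ∧ isYes q then t else e) ≡ t
  if-both (yes _) (yes _) _       = refl
  if-both (yes _) (no ¬q) (_ , q) = contradiction q ¬q
  if-both (no ¬p) _       (p , _) = contradiction p ¬p

  if-not-both : (p : Dec P) (q : Dec Q) → ¬ (P × Q) → (if isYes p ∧ isYes q then t else e) ≡ e
  if-not-both (yes p) (yes q) ¬pq = contradiction (p , q) ¬pq
  if-not-both (yes _) (no _)  _   = refl
  if-not-both (no _)  _       _   = refl

addArc-added : (F : Orient n) (u v : Fin n) → addArc F u v u v ≡ true
addArc-added F u v = if-both (u ≟ u) (v ≟ v) (refl , refl)

addArc-elsewhere : (F : Orient n) → ¬ (a ≡ u × c ≡ v) → addArc F u v a c ≡ F a c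
addArc-elsewhere {a = a} {u} {c} {v} F = if-not-both (a ≟ u) (c ≟ v)

addArc-arc : (F : Orient n) (u v : Fin n) → Arc (addArc F u v) a c → Arc F a c ⊎ (a ≡ u × c ≡ v)
addArc-arc {a = a} {c} F u v e with (a ≟ u) ×-dec (c ≟ v)
... | yes added = inj₂ added
... | no ne     = inj₁ (trans (sym (addArc-elsewhere F ne)) e)

addArc-mono : (F : Orient n) (u v : Fin n) → Arc F a c → Arc (addArc F u v) a c
addArc-mono {a = a} {c} F u v e with (a ≟ u) ×-dec (c ≟ v)
... | yes (refl , refl) = addArc-added F u v
... | no ne             = trans (addArc-elsewhere F ne) e

flipArc-reversed : (F : Orient n) (x y : Fin n) → flipArc F x y y x ≡ true
flipArc-reversed F x y = if-both (y ≟ y) (x ≟ x) (refl , refl)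

flipArc-elsewhere : (F : Orient n) → ¬ (a ≡ y × c ≡ x) → ¬ (a ≡ x × c ≡ y) → flipArc F x y a c ≡ F a c
flipArc-elsewhere {a = a} {y} {c} {x} F ne₁ ne₂ =
  trans (if-not-both (a ≟ y) (c ≟ x) ne₁) (if-not-both (a ≟ x) (c ≟ y) ne₂)

flipArc-removed : (F : Orient n) → x ≢ y → flipArc F x y x y ≡ false
flipArc-removed {x = x} {y} F x≢y =
  trans (if-not-both (x ≟ y) (y ≟ x) (x≢y ∘ proj₁)) (if-both (x ≟ x) (y ≟ y) (refl , refl))

flipArc-arc : (F : Orient n) (x y : Fin n) → Arc (flipArc F x y) a c → Arc F a c ⊎ (a ≡ y × c ≡ x)
flipArc-arc {a = a} {c} F x y e with (a ≟ y) ×-dec (c ≟ x) | (a ≟ x) ×-dec (c ≟ y)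
... | yes reversed | _                 = inj₂ reversed
... | no ne₁       | no ne₂            = inj₁ (trans (sym (flipArc-elsewhere F ne₁ ne₂)) e)
... | no ne₁       | yes (refl , refl) =
  contradiction (trans (sym (flipArc-removed F (λ x≡y → ne₁ (x≡y , sym x≡y)))) e) λ ()

odeg-addArc-tail : (F : Orient n) (u v : Fin n) → F u v ≡ false →
                   odeg (addArc F u v) u ≡ suc (odeg F u)
odeg-addArc-tail F u v Fuv =
  odeg-insert (addArc F u v) F u v (λ z z≢v → addArc-elsewhere F (z≢v ∘ proj₂))
              (addArc-added F u v) Fuv

odeg-addArc-other : (F : Orient n) (u v : Fin n) → x ≢ u → odeg (addArc F u v) x ≡ odeg F x
odeg-addArc-other {x = x} F u v x≢u =
  odeg-cong (addArc F u v) F x (λ z → addArc-elsewhere F (x≢u ∘ proj₁))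

odeg-addArc-mono : (F : Orient n) (u v x : Fin n) → odeg F x ≤ odeg (addArc F u v) x
odeg-addArc-mono F u v x = odeg-mono F (addArc F u v) x (λ z → addArc-mono F u v)

odeg-flipArc-tail : (F : Orient n) (x y : Fin n) → x ≢ y → F x y ≡ true →
                    odeg F x ≡ suc (odeg (flipArc F x y) x)
odeg-flipArc-tail F x y x≢y Fxy =
  odeg-insert F (flipArc F x y) x y
              (λ z z≢y → sym (flipArc-elsewhere F (x≢y ∘ proj₁) (z≢y ∘ proj₂)))
              Fxy (flipArc-removed F x≢y)

odeg-flipArc-head : (F : Orient n) (x y : Fin n) → x ≢ y → F y x ≡ false →
                    odeg (flipArc F x y) y ≡ suc (odeg F y)
odeg-flipArc-head F x y x≢y Fyx =
  odeg-insert (flipArc F x y) F y x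
              (λ z z≢x → flipArc-elsewhere F (z≢x ∘ proj₂) (x≢y ∘ sym ∘ proj₁))
              (flipArc-reversed F x y) Fyx

odeg-flipArc-other : (F : Orient n) (x y : Fin n) → a ≢ x → a ≢ y → odeg (flipArc F x y) a ≡ odeg F a
odeg-flipArc-other {a = a} F x y a≢x a≢y =
  odeg-cong (flipArc F x y) F a (λ z → flipArc-elsewhere F (a≢y ∘ proj₁) (a≢x ∘ proj₁))

Reach : Orient n → Fin n → Fin n → Set
Reach F = Star (Arc F)

SimplePath : Orient n → Fin n → Fin n → Set
SimplePath {n} F x z =
  Σ (List (Fin n)) λ xs → Linked (Arc F) (x ∷ xs) × Unique (x ∷ xs) × last (x ∷ xs) ≡ z

last-∷⁺ : {A : Set} (x : A) (p : List⁺ A) → last (x ∷⁺ p) ≡ last p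
last-∷⁺ x (y ∷ ys) with initLast ys
... | []       = refl
... | _ ∷ʳ′ _  = refl

linked⇒reach : (p : List⁺ (Fin n)) → Linked (Arc F) (toList p) → Reach F (head p) (last p)
linked⇒reach (x ∷ [])     _        = ε
linked⇒reach {F = F} (x ∷ y ∷ ys) (x→y ∷ lk) =
  x→y ◅ subst (Reach F y) (sym (last-∷⁺ x (y ∷ ys))) (linked⇒reach (y ∷ ys) lk)

simplePath-suffix : (p : List⁺ (Fin n)) → x ∈ toList p →
                    Linked (Arc F) (toList p) → Unique (toList p) → SimplePath F x (last p)
simplePath-suffix (y ∷ ys)      (here refl) lk        uq        = ys , lk , uq , refl
simplePath-suffix (y ∷ y′ ∷ ys) (there x∈)  (_ ∷ lk) (_ ∷ uq) =
  let xs , lk′ , uq′ , ends = simplePath-suffix (y′ ∷ ys) x∈ lk uq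
  in  xs , lk′ , uq′ , trans ends (sym (last-∷⁺ y (y′ ∷ ys)))

reach⇒simplePath : Reach F x z → SimplePath F x z
reach⇒simplePath ε = [] , [-] , [] ∷ [] , refl
reach⇒simplePath {x = x} (_◅_ {j = y} x→y w) with reach⇒simplePath w
... | ys , lk , uq , ends with any? (x ≟_) (y ∷ ys)
...   | yes x∈ = let xs , lk′ , uq′ , ends′ = simplePath-suffix (y ∷ ys) x∈ lk uq
                 in  xs , lk′ , uq′ , trans ends′ ends
...   | no x∉  = y ∷ ys , x→y ∷ lk , ¬Any⇒All¬ _ x∉ ∷ uq , trans (last-∷⁺ x (y ∷ ys)) ends

NoImprovingWalk : Orient n → Set
NoImprovingWalk F = ∀ {x z} → Reach F x z → odeg F x ≤ suc (odeg F z)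

noImprovingPath⇒noImprovingWalk : NoImprovingPath F → NoImprovingWalk F
noImprovingPath⇒noImprovingWalk noPath {x} w with reach⇒simplePath w
... | xs , lk , uq , refl = ≮⇒≥ λ improving → noPath (x ∷ xs) (lk , uq , improving)

noImprovingWalk⇒noImprovingPath : NoImprovingWalk F → NoImprovingPath F
noImprovingWalk⇒noImprovingPath noWalk p (lk , _ , improving) =
  <⇒≱ improving (noWalk (linked⇒reach p lk))

SteepArc : Orient n → Fin n → Fin n → Set
SteepArc F a c = Arc F a c × suc (odeg F c) < odeg F a

steepArc⇒≢ : SteepArc F a c → a ≢ c
steepArc⇒≢ (_ , steep) refl = <-irrefl refl (<-trans (n<1+n _) steep)

steepArc⇒improvingPath : SteepArc F a c → IsImprovingPath F (a ∷ c ∷ [])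
steepArc⇒improvingPath (a→c , steep) =
  a→c ∷ [-] , (steepArc⇒≢ (a→c , steep) ∷ []) ∷ [] ∷ [] , steep

mutual
  findAndFlip-found : ∀ {vis F′ P} → FindAndFlip F vis x (found F′ P) →
                      (∃ λ y → SteepArc F x y × F′ ≡ flipArc F x y) ⊎
                      (∃₂ λ a c → SteepArc F a c × odeg F a < odeg F x)
  findAndFlip-found (direct _ x→y steep) = inj₁ (_ , (x→y , steep) , refl)
  findAndFlip-found (scan _ _ sc)        = inj₂ (scan-found sc)

  scan-found : ∀ {tried vis F′ P} → Scan F x tried vis (found F′ P) →
               ∃₂ λ a c → SteepArc F a c × odeg F a < odeg F x
  scan-found (next _ _ _ _ sc) = scan-found sc
  scan-found (succ _ dy+1≡dx _ ff) with findAndFlip-found ff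
  ... | inj₁ (c , steep , _)     = _ , c , steep , ≤-reflexive dy+1≡dx
  ... | inj₂ (a , c , steep , a<y) = a , c , steep , <-trans a<y (≤-reflexive dy+1≡dx)

steepArc-addArc⇒tail : NoImprovingPath F → SteepArc (addArc F u v) a c → a ≡ u
steepArc-addArc⇒tail {F = F} {u} {v} {a} {c} noPath (a→c , steep) =
  decidable-stable (a ≟ u) λ a≢u →
    noPath (a ∷ c ∷ []) (steepArc⇒improvingPath (a→c′ a≢u , steep′ a≢u))
  where
  open ≤-Reasoning
  a→c′ : a ≢ u → Arc F a c
  a→c′ a≢u = trans (sym (addArc-elsewhere F (a≢u ∘ proj₁))) a→c
  steep′ : a ≢ u → suc (odeg F c) < odeg F a
  steep′ a≢u = begin-strict
    suc (odeg F c)              ≤⟨ s≤s (odeg-addArc-mono F u v c) ⟩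
    suc (odeg (addArc F u v) c) <⟨ steep ⟩
    odeg (addArc F u v) a       ≡⟨ odeg-addArc-other F u v a≢u ⟩
    odeg F a                    ∎

steepArc-addArc-at-tail : F u v ≡ false → odeg F u ≤ odeg F v → SteepArc (addArc F u v) u c →
                          c ≢ v × Arc F u c × odeg F c < odeg F u
steepArc-addArc-at-tail {F = F} {u} {v} {c} Fuv du≤dv (u→c , steep) = c≢v , u→c′ , c<u
  where
  c<u₁ : odeg (addArc F u v) c < odeg F u
  c<u₁ = ≤-pred (subst (suc (odeg (addArc F u v) c) <_) (odeg-addArc-tail F u v Fuv) steep)
  c<u : odeg F c < odeg F u
  c<u = ≤-trans (s≤s (odeg-addArc-mono F u v c)) c<u₁
  c≢v : c ≢ v
  c≢v refl = <⇒≱ c<u₁ (≤-trans du≤dv (odeg-addArc-mono F u v c))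
  u→c′ : Arc F u c
  u→c′ = trans (sym (addArc-elsewhere F (c≢v ∘ proj₂))) u→c

module InsertThenFlip (D : Orient n) (noWalk : NoImprovingWalk D) {u v b : Fin n}
  (u→b : Arc D u b) (b↛u : D b u ≡ false) (u↛v : D u v ≡ false) (u≢b : u ≢ b) (b≢v : b ≢ v)
  (du≤dv : odeg D u ≤ odeg D v) (db<du : odeg D b < odeg D u) where

  E : Orient n
  E = flipArc (addArc D u v) u b

  odeg-E-tail : odeg E u ≡ odeg D u
  odeg-E-tail = suc-injective (begin
    suc (odeg E u)        ≡⟨ odeg-flipArc-tail (addArc D u v) u b u≢b (addArc-mono D u v u→b) ⟨
    odeg (addArc D u v) u ≡⟨ odeg-addArc-tail D u v u↛v ⟩
    suc (odeg D u)        ∎)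
    where open ≡-Reasoning

  odeg-E-head : odeg E b ≡ suc (odeg D b)
  odeg-E-head = begin
    odeg E b                    ≡⟨ odeg-flipArc-head (addArc D u v) u b u≢b b↛u₁ ⟩
    suc (odeg (addArc D u v) b) ≡⟨ cong suc (odeg-addArc-other D u v (u≢b ∘ sym)) ⟩
    suc (odeg D b)              ∎
    where
    open ≡-Reasoning
    b↛u₁ : addArc D u v b u ≡ false
    b↛u₁ = trans (addArc-elsewhere D (u≢b ∘ sym ∘ proj₁)) b↛u

  odeg-E-other : x ≢ u → x ≢ b → odeg E x ≡ odeg D x
  odeg-E-other x≢u x≢b =
    trans (odeg-flipArc-other (addArc D u v) u b x≢u x≢b) (odeg-addArc-other D u v x≢u)

  odeg-D≤E : ∀ x → odeg D x ≤ odeg E x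
  odeg-D≤E x = case x ≟ u of λ
    { (yes refl) → ≤-reflexive (sym odeg-E-tail)
    ; (no x≢u)   → case x ≟ b of λ
      { (yes refl) → ≤-trans (n≤1+n _) (≤-reflexive (sym odeg-E-head))
      ; (no x≢b)   → ≤-reflexive (sym (odeg-E-other x≢u x≢b))
      }
    }

  odeg-E≤D : x ≢ b → odeg E x ≤ odeg D x
  odeg-E≤D {x} x≢b = case x ≟ u of λ
    { (yes refl) → ≤-reflexive odeg-E-tail
    ; (no x≢u)   → ≤-reflexive (odeg-E-other x≢u x≢b)
    }

  odeg-E-bound : Reach D x z → odeg E x ≤ suc (odeg D z)
  odeg-E-bound {x} w = case x ≟ b of λ
    { (yes refl) → ≤-trans (≤-reflexive odeg-E-head) (≤-trans db<du (noWalk (u→b ◅ w)))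
    ; (no x≢b)   → ≤-trans (odeg-E≤D x≢b) (noWalk w)
    }

  arc-E : Arc E x y → Arc D x y ⊎ (x ≡ u × y ≡ v) ⊎ (x ≡ b × y ≡ u)
  arc-E x→y with flipArc-arc (addArc D u v) u b x→y
  ... | inj₂ reversed = inj₂ (inj₂ reversed)
  ... | inj₁ x→y₁ with addArc-arc D u v x→y₁
  ...   | inj₁ x→y₀ = inj₁ x→y₀
  ...   | inj₂ added = inj₂ (inj₁ added)

  odeg-b≤-reach : {w : Fin n} → odeg D u ≤ odeg D w → Reach D w z → odeg D b ≤ odeg D z
  odeg-b≤-reach du≤dw w = ≤-pred (≤-trans db<du (≤-trans du≤dw (noWalk w)))

  arc-E-lift : Arc E x y → Reach D y z → ∃ λ z′ → Reach D x z′ × odeg D z′ ≤ odeg D z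
  arc-E-lift {z = z} x→y w with arc-E x→y
  ... | inj₁ x→y₀                 = z , x→y₀ ◅ w , ≤-refl
  ... | inj₂ (inj₁ (refl , refl)) = b , u→b ◅ ε , odeg-b≤-reach du≤dv w
  ... | inj₂ (inj₂ (refl , refl)) = b , ε , odeg-b≤-reach ≤-refl w

  reach-E-lift : Reach E x y → ∃ λ z → Reach D x z × odeg D z ≤ odeg D y
  reach-E-lift ε = _ , ε , ≤-refl
  reach-E-lift (x→y ◅ w) with reach-E-lift w
  ... | z , w₀ , dz≤dy with arc-E-lift x→y w₀
  ...   | z′ , w₀′ , dz′≤dz = z′ , w₀′ , ≤-trans dz′≤dz dz≤dy

  noImprovingWalk-E : NoImprovingWalk E
  noImprovingWalk-E {x} {y} w with reach-E-lift w
  ... | z , w₀ , dz≤dy = begin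
    odeg E x       ≤⟨ odeg-E-bound w₀ ⟩
    suc (odeg D z) ≤⟨ s≤s dz≤dy ⟩
    suc (odeg D y) ≤⟨ s≤s (odeg-D≤E y) ⟩
    suc (odeg E y) ∎
    where open ≤-Reasoning

lemma3p5 : {n : ℕ} (D : Orient n) → IsOrientation D → NoImprovingPath D →
           (u v : Fin n) → ¬ (u ≡ v) → D u v ≡ false → D v u ≡ false →
           odeg D u ≤ odeg D v →
           (D' : Orient n) (P : List⁺ (Fin n)) →
           FindAndFlip (addArc D u v) allFalse u (found D' P) →
           NoImprovingPath D'
lemma3p5 D isOrientation noPath u v _ u↛v _ du≤dv D' _ run with findAndFlip-found run
... | inj₂ (a , _ , steep , a<u) =
  ⊥-elim (<-irrefl (cong (odeg (addArc D u v)) (steepArc-addArc⇒tail noPath steep)) a<u)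
... | inj₁ (b , steep , refl) =
  let b≢v , u→b , db<du = steepArc-addArc-at-tail u↛v du≤dv steep
  in  noImprovingWalk⇒noImprovingPath
        (InsertThenFlip.noImprovingWalk-E D (noImprovingPath⇒noImprovingWalk noPath)
          u→b (antisym u b u→b) u↛v (steepArc⇒≢ steep) b≢v du≤dv db<du)
  where open IsOrientation isOrientation
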